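{- Let $m$, $c$, $d$ be fixed integers. There is a bound $f(m,c,d)$ such that the following holds. Let $G$ be a $(P_m,\overline{K_3+2P_1})$-free graph, and let $S,T$ be two disjoint subsets of $V(G)$ such that $|S|\le c$, $\chi(G[T])\le d$, and $G[T\cup S]$ is connected. Suppose that for any two nonadjacent vertices $x_1,x_2\in T$, every vertex of $S$ is nonadjacent to at least one of $x_1,x_2$, and suppose there exists a vertex $w\in V(G)\setminus (S\cup T)$ adjacent to every vertex of $S\cup T$. Then $|T|\le f(m,c,d)$.
   Context: All graphs are finite, simple and undirected. $P_m$ is the path on $m$ vertices, $K_3$ the triangle, $2P_1$ two isolated vertices, $+$ disjoint union and $\overline{H}$ the complement of $H$. A graph is $(H_1,H_2)$-free if it contains no induced subgraph isomorphic to $H_1$ or to $H_2$. $G[X]$ denotes the subgraph induced by $X$ and $\chi$ the chromatic number. -}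

module Defs where

open import Data.Nat using (ℕ; zero; suc; _+_; _≤_)
import Data.Nat as ℕ
import Data.Nat.Properties as ℕP
open import Data.Bool using (Bool; true; false; _∧_; _∨_; not; if_then_else_)
open import Data.Bool.Properties using (∨-comm)
open import Data.Fin using (Fin; toℕ; splitAt; _≟_)
open import Data.Fin.Subset using (Subset; _∈_; _∉_; _∪_; ∣_∣)
open import Data.Sum using (_⊎_; inj₁; inj₂)
open import Data.Product using (Σ; ∃; _×_; _,_)
open import Data.Empty using (⊥)
open import Relation.Binary.PropositionalEquality using (_≡_; _≢_; refl; sym; cong)
open import Relation.Nullary using (yes; no)
open import Relation.Nullary.Decidable using (⌊_⌋)
open import Function.Definitions using (Injective)

record Graph (n : ℕ) : Set where
  field
    adj    : Fin n → Fin n → Bool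
    adj-sym    : ∀ i j → adj i j ≡ adj j i
    adj-irrefl : ∀ i → adj i i ≡ false
open Graph public

complement : ∀ {n} → Graph n → Graph n
complement {n} G = record { adj = a ; adj-sym = s ; adj-irrefl = r }
  where
  a : Fin n → Fin n → Bool
  a i j with i ≟ j
  ... | yes _ = false
  ... | no  _ = not (adj G i j)
  s : ∀ i j → a i j ≡ a j i
  s i j with i ≟ j | j ≟ i
  ... | yes _ | yes _ = refl
  ... | yes p | no q = Data.Empty.⊥-elim (q (sym p))
  ... | no p | yes q = Data.Empty.⊥-elim (p (sym q))
  ... | no _ | no _ = cong not (adj-sym G i j)
  r : ∀ i → a i i ≡ false
  r i with i ≟ i
  ... | yes _ = refl
  ... | no p = Data.Empty.⊥-elim (p refl)

_+G_ : ∀ {m n} → Graph m → Graph n → Graph (m + n)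
_+G_ {m} {n} G H = record { adj = a ; adj-sym = s ; adj-irrefl = r }
  where
  a : Fin (m + n) → Fin (m + n) → Bool
  a i j with splitAt m i | splitAt m j
  ... | inj₁ x | inj₁ y = adj G x y
  ... | inj₂ x | inj₂ y = adj H x y
  ... | _ | _ = false
  s : ∀ i j → a i j ≡ a j i
  s i j with splitAt m i | splitAt m j
  ... | inj₁ x | inj₁ y = adj-sym G x y
  ... | inj₂ x | inj₂ y = adj-sym H x y
  ... | inj₁ _ | inj₂ _ = refl
  ... | inj₂ _ | inj₁ _ = refl
  r : ∀ i → a i i ≡ false
  r i with splitAt m i
  ... | inj₁ x = adj-irrefl G x
  ... | inj₂ x = adj-irrefl H x

edgeless : ∀ k → Graph k
edgeless k = record { adj = λ _ _ → false ; adj-sym = λ _ _ → refl ; adj-irrefl = λ _ → refl }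

complete : ∀ k → Graph k
complete k = complement (edgeless k)

K₃ : Graph 3
K₃ = complete 3

path : ∀ m → Graph m
path m = record { adj = a ; adj-sym = s ; adj-irrefl = r }
  where
  a : Fin m → Fin m → Bool
  a i j = ⌊ toℕ i ℕ.≟ suc (toℕ j) ⌋ ∨ ⌊ toℕ j ℕ.≟ suc (toℕ i) ⌋
  s : ∀ i j → a i j ≡ a j i
  s i j = ∨-comm ⌊ toℕ i ℕ.≟ suc (toℕ j) ⌋ ⌊ toℕ j ℕ.≟ suc (toℕ i) ⌋
  r : ∀ i → a i i ≡ false
  r i with toℕ i ℕ.≟ suc (toℕ i)
  ... | yes p = Data.Empty.⊥-elim (ℕP.<⇒≢ (ℕP.n<1+n (toℕ i)) p)
  ... | no _ = refl

coK3+2P1 : Graph 5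
coK3+2P1 = complement (K₃ +G edgeless 2)

ContainsInduced : ∀ {n k} → Graph n → Graph k → Set
ContainsInduced {n} {k} G H =
  Σ (Fin k → Fin n) λ f → Injective _≡_ _≡_ f × (∀ i j → adj H i j ≡ adj G (f i) (f j))

Free : ∀ {n k} → Graph n → Graph k → Set
Free G H = ContainsInduced G H → ⊥

data Reach {n} (G : Graph n) (X : Subset n) (u : Fin n) : Fin n → Set where
  here : u ∈ X → Reach G X u u
  step : ∀ {v w} → Reach G X u v → adj G v w ≡ true → w ∈ X → Reach G X u w

Connected : ∀ {n} → Graph n → Subset n → Set
Connected G X = ∀ u v → u ∈ X → v ∈ X → Reach G X u v

ColourableOn : ∀ {n} → Graph n → Subset n → ℕ → Set
ColourableOn {n} G X d =
  Σ (Fin n → Fin d) λ col →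
    ∀ u v → u ∈ X → v ∈ X → adj G u v ≡ true → col u ≢ col v

module Submission where

-- Every u ∈ S ∪ T has at most 2d + c neighbours in S ∪ T: at most c in S, and at
-- most two in each colour class of T, since three pairwise nonadjacent common
-- neighbours of the adjacent pair u, w would induce the complement of K₃ + 2P₁.
-- In a P_m-free graph every geodesic has fewer than m vertices, because it is an
-- induced path; so the connected set S ∪ T lies in the ball of radius m around any
-- of its vertices, and that ball has at most (2d + c + 1)^m elements.

open import Defs
open import Level using (Level)
import Data.Nat as ℕ
open import Data.Nat
  using (ℕ; zero; suc; _+_; _*_; _^_; _≤_; _<_; _≤′_; ≤′-refl; ≤′-step; z≤n; s≤s; _≤?_)
open import Data.Nat.Properties
  using (≤-trans; ≤-reflexive; +-monoʳ-≤; +-mono-≤; +-suc; *-suc; *-comm; *-monoˡ-≤;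
         m≤n⇒m≤1+n; ≤⇒≤′; <⇒≤; ≰⇒>; module ≤-Reasoning)
open import Data.Fin using (Fin; zero; suc; toℕ; _≟_)
open import Data.Fin.Properties using (¬Fin0)
open import Data.Fin.Subset renaming (⊥ to ∅)
open import Data.Fin.Subset.Properties
open import Data.Fin.Patterns using (0F; 1F; 2F; 3F; 4F)
open import Data.Vec using (Vec; []; _∷_; lookup; tabulate; here; there)
open import Data.Vec.Relation.Unary.All using ([]; _∷_)
open import Data.Vec.Relation.Unary.AllPairs using ([]; _∷_)
open import Data.Vec.Relation.Unary.Unique.Propositional using (Unique)
open import Data.Vec.Relation.Unary.Unique.Propositional.Properties using (lookup-injective)
open import Data.Vec.Properties using (lookup∘tabulate; []=⇒lookup; lookup⇒[]=)
open import Data.Bool using (true; false; _∨_)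
import Data.Bool as Bool
open import Data.Bool.Properties using (T-≡; not-¬; ¬-not)
open import Data.Sum using (_⊎_; inj₁; inj₂)
open import Data.Product using (Σ; ∃; _×_; _,_; proj₂)
open import Data.Empty using (⊥; ⊥-elim)
open import Function using (_∘_; Equivalence)
open import Function.Definitions using (Injective)
open import Relation.Unary using (Pred; Decidable)
open import Relation.Nullary using (yes; no)
open import Relation.Nullary.Decidable using (⌊_⌋; toWitness; fromWitness; isYes≗does)
open import Relation.Binary.PropositionalEquality
  using (_≡_; _≢_; refl; sym; trans; cong; cong₂; subst; ≢-sym)

private
  variable
    ℓ : Level
    n k : ℕ

∣p∪q∣≤∣p∣+∣q∣ : (p q : Subset n) → ∣ p ∪ q ∣ ≤ ∣ p ∣ + ∣ q ∣
∣p∪q∣≤∣p∣+∣q∣ []            []            = z≤n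
∣p∪q∣≤∣p∣+∣q∣ (outside ∷ p) (outside ∷ q) = ∣p∪q∣≤∣p∣+∣q∣ p q
∣p∪q∣≤∣p∣+∣q∣ (outside ∷ p) (inside  ∷ q) =
  subst (∣ p ∪ q ∣ <_) (sym (+-suc ∣ p ∣ ∣ q ∣)) (s≤s (∣p∪q∣≤∣p∣+∣q∣ p q))
∣p∪q∣≤∣p∣+∣q∣ (inside  ∷ p) (s       ∷ q) =
  s≤s (≤-trans (∣p∪q∣≤∣p∣+∣q∣ p q) (+-monoʳ-≤ ∣ p ∣ (∣p∣≤∣x∷p∣ s q)))

⋃[_]_ : Subset k → (Fin k → Subset n) → Subset n
⋃[ []          ] g = ∅
⋃[ inside  ∷ A ] g = g zero ∪ ⋃[ A ] (g ∘ suc)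
⋃[ outside ∷ A ] g = ⋃[ A ] (g ∘ suc)

x∈⋃[]⁺ : ∀ {A : Subset k} {g : Fin k → Subset n} {i x} → i ∈ A → x ∈ g i → x ∈ ⋃[ A ] g
x∈⋃[]⁺ {A = inside  ∷ A}         here        x∈g = x∈p∪q⁺ (inj₁ x∈g)
x∈⋃[]⁺ {A = inside  ∷ A} {g = g} (there i∈A) x∈g = x∈p∪q⁺ (inj₂ (x∈⋃[]⁺ {g = g ∘ suc} i∈A x∈g))
x∈⋃[]⁺ {A = outside ∷ A} {g = g} (there i∈A) x∈g = x∈⋃[]⁺ {g = g ∘ suc} i∈A x∈g

x∈⋃[]⁻ : ∀ (A : Subset k) (g : Fin k → Subset n) {x} → x ∈ ⋃[ A ] g → ∃ λ i → i ∈ A × x ∈ g i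
x∈⋃[]⁻ []            g x∈ = ⊥-elim (∉⊥ x∈)
x∈⋃[]⁻ (inside  ∷ A) g x∈ with x∈p∪q⁻ (g zero) (⋃[ A ] (g ∘ suc)) x∈
... | inj₁ x∈g = zero , here , x∈g
... | inj₂ x∈⋃ with x∈⋃[]⁻ A (g ∘ suc) x∈⋃
...   | i , i∈A , x∈g = suc i , there i∈A , x∈g
x∈⋃[]⁻ (outside ∷ A) g x∈ with x∈⋃[]⁻ A (g ∘ suc) x∈
... | i , i∈A , x∈g = suc i , there i∈A , x∈g

∣⋃[]∣≤ : ∀ {B} (A : Subset k) (g : Fin k → Subset n) →
         (∀ {i} → i ∈ A → ∣ g i ∣ ≤ B) → ∣ ⋃[ A ] g ∣ ≤ ∣ A ∣ * B
∣⋃[]∣≤ {n = n} [] g _ = ≤-reflexive (∣⊥∣≡0 n)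
∣⋃[]∣≤ (inside ∷ A) g bound = ≤-trans (∣p∪q∣≤∣p∣+∣q∣ (g zero) _)
  (+-mono-≤ (bound here) (∣⋃[]∣≤ A (g ∘ suc) (bound ∘ there)))
∣⋃[]∣≤ (outside ∷ A) g bound = ∣⋃[]∣≤ A (g ∘ suc) (bound ∘ there)

subsetOf : {P : Pred (Fin n) ℓ} → Decidable P → Subset n
subsetOf P? = tabulate (⌊_⌋ ∘ P?)

x∈subsetOf⁺ : {P : Pred (Fin n) ℓ} (P? : Decidable P) → ∀ {x} → P x → x ∈ subsetOf P?
x∈subsetOf⁺ P? {x} px =
  lookup⇒[]= x _ (trans (lookup∘tabulate _ x) (Equivalence.to T-≡ (fromWitness px)))

x∈subsetOf⁻ : {P : Pred (Fin n) ℓ} (P? : Decidable P) → ∀ {x} → x ∈ subsetOf P? → P x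
x∈subsetOf⁻ P? {x} x∈ =
  toWitness (Equivalence.from T-≡ (trans (sym (lookup∘tabulate _ x)) ([]=⇒lookup x∈)))

x∈p─q⇒x∉q : ∀ {p q : Subset n} {x} → x ∈ p ─ q → x ∉ q
x∈p─q⇒x∉q {p = _ ∷ p} {outside ∷ q} here ()
x∈p─q⇒x∉q {p = _ ∷ p} {_       ∷ q} (there x∈p─q) (there x∈q) = x∈p─q⇒x∉q x∈p─q x∈q

x∈p-y⇒x≢y : ∀ {p : Subset n} {x y} → x ∈ p - y → x ≢ y
x∈p-y⇒x≢y x∈p-y refl = x∈p─q⇒x∉q x∈p-y (x∈⁅x⁆ _)

∣p∣≤1+∣p-x∣ : ∀ (p : Subset n) x → ∣ p ∣ ≤ suc ∣ p - x ∣
∣p∣≤1+∣p-x∣ p x = begin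
  ∣ p ∣                  ≤⟨ p⊆q⇒∣p∣≤∣q∣ p⊆⁅x⁆∪p-x ⟩
  ∣ ⁅ x ⁆ ∪ (p - x) ∣    ≤⟨ ∣p∪q∣≤∣p∣+∣q∣ ⁅ x ⁆ (p - x) ⟩
  ∣ ⁅ x ⁆ ∣ + ∣ p - x ∣  ≡⟨ cong (_+ ∣ p - x ∣) (∣⁅x⁆∣≡1 x) ⟩
  suc ∣ p - x ∣          ∎
  where
  open ≤-Reasoning
  p⊆⁅x⁆∪p-x : p ⊆ ⁅ x ⁆ ∪ (p - x)
  p⊆⁅x⁆∪p-x {y} y∈p with y ≟ x
  ... | yes refl = x∈p∪q⁺ (inj₁ (x∈⁅x⁆ x))
  ... | no  y≢x  = x∈p∪q⁺ (inj₂ (x∈p∧x≢y⇒x∈p-y y∈p y≢x))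

∣p∣≤k-from-Nonempty : ∀ {p : Subset n} {k} → (Nonempty p → ∣ p ∣ ≤ k) → ∣ p ∣ ≤ k
∣p∣≤k-from-Nonempty {n} {p} bound with nonempty? p
... | yes p≠∅ = bound p≠∅
... | no  p≡∅ rewrite Empty-unique p≡∅ | ∣⊥∣≡0 n = z≤n

AtMost : ℕ → Subset n → Set
AtMost zero    p = Empty p
AtMost (suc k) p = ∀ {x} → x ∈ p → AtMost k (p - x)

AtMost⇒∣p∣≤ : ∀ k (p : Subset n) → AtMost k p → ∣ p ∣ ≤ k
AtMost⇒∣p∣≤ {n} zero p empty rewrite Empty-unique empty = ≤-reflexive (∣⊥∣≡0 n)
AtMost⇒∣p∣≤ (suc k) p atMost = ∣p∣≤k-from-Nonempty λ (x , x∈p) →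
  ≤-trans (∣p∣≤1+∣p-x∣ p x) (s≤s (AtMost⇒∣p∣≤ k (p - x) (atMost x∈p)))

fibre : (Fin n → Fin k) → Fin k → Subset n
fibre h i = subsetOf (λ x → h x ≟ i)

∣p∣≤k*B-by-fibres : ∀ {B} (h : Fin n → Fin k) (p : Subset n) →
                    (∀ i → ∣ p ∩ fibre h i ∣ ≤ B) → ∣ p ∣ ≤ k * B
∣p∣≤k*B-by-fibres {k = k} {B} h p bound = begin
  ∣ p ∣                            ≤⟨ p⊆q⇒∣p∣≤∣q∣ p⊆⋃fibres ⟩
  ∣ ⋃[ ⊤ ] (λ i → p ∩ fibre h i) ∣ ≤⟨ ∣⋃[]∣≤ ⊤ _ (λ {i} _ → bound i) ⟩
  ∣ ⊤ {k} ∣ * B                    ≡⟨ cong (_* B) (∣⊤∣≡n k) ⟩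
  k * B                            ∎
  where
  open ≤-Reasoning
  p⊆⋃fibres : p ⊆ ⋃[ ⊤ ] (λ i → p ∩ fibre h i)
  p⊆⋃fibres {x} x∈p =
    x∈⋃[]⁺ {i = h x} ∈⊤ (x∈p∩q⁺ (x∈p , x∈subsetOf⁺ (λ y → h y ≟ h x) refl))

neighbours : Graph n → Fin n → Subset n
neighbours G u = subsetOf (λ v → adj G u v Bool.≟ true)

Independent : Graph n → Subset n → Set
Independent G I = ∀ {x y} → x ∈ I → y ∈ I → adj G x y ≡ false

adj⇒≢ : (G : Graph n) → ∀ {x y} → adj G x y ≡ true → x ≢ y
adj⇒≢ G xy refl = not-¬ (adj-irrefl G _) xy

coK3+2P1-induced : (G : Graph n) {a b c u w : Fin n} → a ≢ b → a ≢ c → b ≢ c →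
  adj G a b ≡ false → adj G a c ≡ false → adj G b c ≡ false →
  adj G u a ≡ true → adj G u b ≡ true → adj G u c ≡ true →
  adj G w a ≡ true → adj G w b ≡ true → adj G w c ≡ true →
  adj G u w ≡ true → ContainsInduced G coK3+2P1
coK3+2P1-induced G {a} {b} {c} {u} {w} a≢b a≢c b≢c ab ac bc ua ub uc wa wb wc uw =
  lookup vertices , (λ {i} {j} → lookup-injective distinct i j) , adjacency
  where
  vertices : Vec (Fin _) 5
  vertices = a ∷ b ∷ c ∷ u ∷ w ∷ []
  ≢-by : ∀ {x y} → adj G x y ≡ true → y ≢ x
  ≢-by xy = ≢-sym (adj⇒≢ G xy)
  distinct : Unique vertices
  distinct = (a≢b ∷ a≢c ∷ ≢-by ua ∷ ≢-by wa ∷ [])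
           ∷ (b≢c ∷ ≢-by ub ∷ ≢-by wb ∷ [])
           ∷ (≢-by uc ∷ ≢-by wc ∷ [])
           ∷ (adj⇒≢ G uw ∷ [])
           ∷ [] ∷ []
  flip : ∀ {x y β} → adj G x y ≡ β → β ≡ adj G y x
  flip {x} {y} xy = trans (sym xy) (adj-sym G x y)
  irrefl : ∀ x → false ≡ adj G x x
  irrefl x = sym (adj-irrefl G x)
  adjacency : ∀ i j → adj coK3+2P1 i j ≡ adj G (lookup vertices i) (lookup vertices j)
  adjacency 0F 0F = irrefl a
  adjacency 0F 1F = sym ab
  adjacency 0F 2F = sym ac
  adjacency 0F 3F = flip ua
  adjacency 0F 4F = flip wa
  adjacency 1F 0F = flip ab
  adjacency 1F 1F = irrefl b
  adjacency 1F 2F = sym bc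
  adjacency 1F 3F = flip ub
  adjacency 1F 4F = flip wb
  adjacency 2F 0F = flip ac
  adjacency 2F 1F = flip bc
  adjacency 2F 2F = irrefl c
  adjacency 2F 3F = flip uc
  adjacency 2F 4F = flip wc
  adjacency 3F 0F = sym ua
  adjacency 3F 1F = sym ub
  adjacency 3F 2F = sym uc
  adjacency 3F 3F = irrefl u
  adjacency 3F 4F = sym uw
  adjacency 4F 0F = sym wa
  adjacency 4F 1F = sym wb
  adjacency 4F 2F = sym wc
  adjacency 4F 3F = flip uw
  adjacency 4F 4F = irrefl w

independent⊆common-neighbours⇒∣I∣≤2 : (G : Graph n) → Free G coK3+2P1 →
  ∀ {u w} {I : Subset n} → adj G u w ≡ true → Independent G I →
  I ⊆ neighbours G u → I ⊆ neighbours G w → ∣ I ∣ ≤ 2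
independent⊆common-neighbours⇒∣I∣≤2 G free {u} {w} {I} uw independent I⊆Nu I⊆Nw =
  AtMost⇒∣p∣≤ 2 I no-three
  where
  u~ : ∀ {x} → x ∈ I → adj G u x ≡ true
  u~ x∈I = x∈subsetOf⁻ _ (I⊆Nu x∈I)
  w~ : ∀ {x} → x ∈ I → adj G w x ≡ true
  w~ x∈I = x∈subsetOf⁻ _ (I⊆Nw x∈I)
  no-three : AtMost 2 I
  no-three {a} a∈I {b} b∈I-a (c , c∈I-a-b) = free
    (coK3+2P1-induced G (≢-sym b≢a) (≢-sym c≢a) (≢-sym c≢b)
      (independent a∈I b∈I) (independent a∈I c∈I) (independent b∈I c∈I)
      (u~ a∈I) (u~ b∈I) (u~ c∈I) (w~ a∈I) (w~ b∈I) (w~ c∈I) uw)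
    where
    c∈I-a : c ∈ I - a
    c∈I-a = p─q⊆p (I - a) ⁅ b ⁆ c∈I-a-b
    b∈I : b ∈ I
    b∈I = p─q⊆p I ⁅ a ⁆ b∈I-a
    c∈I : c ∈ I
    c∈I = p─q⊆p I ⁅ a ⁆ c∈I-a
    b≢a : b ≢ a
    b≢a = x∈p-y⇒x≢y b∈I-a
    c≢a : c ≢ a
    c≢a = x∈p-y⇒x≢y c∈I-a
    c≢b : c ≢ b
    c≢b = x∈p-y⇒x≢y c∈I-a-b

properly-coloured⇒fibre-independent : (G : Graph n) {T : Subset n} {d : ℕ} →
  ((col , _) : ColourableOn G T d) → ∀ i → Independent G (T ∩ fibre col i)
properly-coloured⇒fibre-independent G (col , proper) i {x} {y} x∈ y∈
  with x∈p∩q⁻ _ _ x∈ | x∈p∩q⁻ _ _ y∈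
... | x∈T , x∈col⁻¹i | y∈T , y∈col⁻¹i = ¬-not λ xy →
  proper x y x∈T y∈T xy (trans (x∈subsetOf⁻ _ x∈col⁻¹i) (sym (x∈subsetOf⁻ _ y∈col⁻¹i)))

∣neighbours∩T∣≤d*2 : (G : Graph n) → Free G coK3+2P1 → ∀ {T d u w} →
  ColourableOn G T d → adj G u w ≡ true → T ⊆ neighbours G w →
  ∣ neighbours G u ∩ T ∣ ≤ d * 2
∣neighbours∩T∣≤d*2 G free {T} {u = u} colouring@(col , _) uw T⊆Nw =
  ∣p∣≤k*B-by-fibres col (neighbours G u ∩ T) λ i →
    independent⊆common-neighbours⇒∣I∣≤2 G free uw
      (λ x∈ y∈ → fibre-independent i (class⊆T∩fibre x∈) (class⊆T∩fibre y∈))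
      (p∩q⊆p _ _ ∘ p∩q⊆p _ _)
      (T⊆Nw ∘ p∩q⊆p _ _ ∘ class⊆T∩fibre)
  where
  fibre-independent : ∀ i → Independent G (T ∩ fibre col i)
  fibre-independent = properly-coloured⇒fibre-independent G colouring
  class⊆T∩fibre : ∀ {i} → (neighbours G u ∩ T) ∩ fibre col i ⊆ T ∩ fibre col i
  class⊆T∩fibre x∈ with x∈p∩q⁻ _ _ x∈
  ... | x∈N∩T , x∈fibre = x∈p∩q⁺ (p∩q⊆q _ _ x∈N∩T , x∈fibre)

∣neighbours∩T∪S∣≤d*2+∣S∣ : (G : Graph n) → Free G coK3+2P1 → ∀ {T S d u w} →
  ColourableOn G T d → adj G u w ≡ true → T ⊆ neighbours G w →
  ∣ neighbours G u ∩ (T ∪ S) ∣ ≤ d * 2 + ∣ S ∣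
∣neighbours∩T∪S∣≤d*2+∣S∣ G free {T} {S} {d} {u} colouring uw T⊆Nw = begin
  ∣ Nᵤ ∩ (T ∪ S) ∣               ≡⟨ cong ∣_∣ (∩-distribˡ-∪ Nᵤ T S) ⟩
  ∣ (Nᵤ ∩ T) ∪ (Nᵤ ∩ S) ∣        ≤⟨ ∣p∪q∣≤∣p∣+∣q∣ (Nᵤ ∩ T) (Nᵤ ∩ S) ⟩
  ∣ Nᵤ ∩ T ∣ + ∣ Nᵤ ∩ S ∣        ≤⟨ +-mono-≤ (∣neighbours∩T∣≤d*2 G free colouring uw T⊆Nw)
                                             (∣p∩q∣≤∣q∣ Nᵤ S) ⟩
  d * 2 + ∣ S ∣                  ∎
  where
  open ≤-Reasoning
  Nᵤ : Subset _
  Nᵤ = neighbours G u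

path-zero-induced : (G : Graph n) → ContainsInduced G (path 0)
path-zero-induced G = (λ ()) , (λ {i} → ⊥-elim (¬Fin0 i)) , λ ()

-- ⌊_⌋ is stuck on open terms, but does (suc a ≟ suc b) reduces to does (a ≟ b).
⌊suc≟suc⌋ : ∀ a b → ⌊ suc a ℕ.≟ suc b ⌋ ≡ ⌊ a ℕ.≟ b ⌋
⌊suc≟suc⌋ a b = trans (isYes≗does (suc a ℕ.≟ suc b)) (sym (isYes≗does (a ℕ.≟ b)))

path-adj-suc : ∀ {m} (i k : Fin m) → adj (path (suc m)) (suc i) (suc k) ≡ adj (path m) i k
path-adj-suc i k =
  cong₂ _∨_ (⌊suc≟suc⌋ (toℕ i) (suc (toℕ k))) (⌊suc≟suc⌋ (toℕ k) (suc (toℕ i)))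

module Ball {n} (G : Graph n) (X : Subset n) (r : Fin n) where

  ball : ℕ → Subset n
  ball zero    = ⁅ r ⁆
  ball (suc j) = ball j ∪ ⋃[ ball j ] (λ u → neighbours G u ∩ X)

  ball-step⁺ : ∀ j {u v} → u ∈ ball j → adj G u v ≡ true → v ∈ X → v ∈ ball (suc j)
  ball-step⁺ _ u∈ball uv v∈X =
    x∈p∪q⁺ (inj₂ (x∈⋃[]⁺ u∈ball (x∈p∩q⁺ (x∈subsetOf⁺ _ uv , v∈X))))

  ball-step⁻ : ∀ j {v} → v ∈ ball (suc j) →
               v ∈ ball j ⊎ ∃ λ u → u ∈ ball j × adj G u v ≡ true × v ∈ X
  ball-step⁻ j v∈ with x∈p∪q⁻ (ball j) _ v∈
  ... | inj₁ v∈ball = inj₁ v∈ball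
  ... | inj₂ v∈⋃ with x∈⋃[]⁻ (ball j) _ v∈⋃
  ...   | u , u∈ball , v∈N∩X with x∈p∩q⁻ _ X v∈N∩X
  ...     | v∈N , v∈X = inj₂ (u , u∈ball , x∈subsetOf⁻ _ v∈N , v∈X)

  ball-mono′ : ∀ {i j} → i ≤′ j → ball i ⊆ ball j
  ball-mono′ ≤′-refl       = λ v∈ → v∈
  ball-mono′ (≤′-step i≤j) = p⊆p∪q _ ∘ ball-mono′ i≤j

  ball-mono : ∀ {i j} → i ≤ j → ball i ⊆ ball j
  ball-mono = ball-mono′ ∘ ≤⇒≤′

  ball⊆X : r ∈ X → ∀ j → ball j ⊆ X
  ball⊆X r∈X zero    v∈ rewrite x∈⁅y⁆⇒x≡y r v∈ = r∈X
  ball⊆X r∈X (suc j) v∈ with ball-step⁻ j v∈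
  ... | inj₁ v∈ball              = ball⊆X r∈X j v∈ball
  ... | inj₂ (_ , _ , _ , v∈X)   = v∈X

  ∣ball∣≤ : r ∈ X → ∀ {Δ} → (∀ {u} → u ∈ X → ∣ neighbours G u ∩ X ∣ ≤ Δ) →
            ∀ j → ∣ ball j ∣ ≤ suc Δ ^ j
  ∣ball∣≤ r∈X {Δ} degree zero    = ≤-reflexive (∣⁅x⁆∣≡1 r)
  ∣ball∣≤ r∈X {Δ} degree (suc j) = begin
    ∣ ball j ∪ ⋃[ ball j ] _ ∣         ≤⟨ ∣p∪q∣≤∣p∣+∣q∣ (ball j) _ ⟩
    ∣ ball j ∣ + ∣ ⋃[ ball j ] _ ∣     ≤⟨ +-monoʳ-≤ ∣ ball j ∣
                                            (∣⋃[]∣≤ (ball j) _ (degree ∘ ball⊆X r∈X j)) ⟩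
    ∣ ball j ∣ + ∣ ball j ∣ * Δ        ≡⟨ *-suc ∣ ball j ∣ Δ ⟨
    ∣ ball j ∣ * suc Δ                 ≤⟨ *-monoˡ-≤ (suc Δ) (∣ball∣≤ r∈X degree j) ⟩
    suc Δ ^ j * suc Δ                  ≡⟨ *-comm (suc Δ ^ j) (suc Δ) ⟩
    suc Δ ^ suc j                      ∎
    where open ≤-Reasoning

  reach⇒ball : ∀ {v} → Reach G X r v → ∃ λ j → v ∈ ball j
  reach⇒ball (here _) = 0 , x∈⁅x⁆ r
  reach⇒ball (step r⇝u uv v∈X) with reach⇒ball r⇝u
  ... | j , u∈ball = suc j , ball-step⁺ j u∈ball uv v∈X

  data Geodesic : ℕ → Fin n → Set where
    root   : Geodesic 0 r
    extend : ∀ {j u v} → Geodesic j u → adj G u v ≡ true → v ∈ X → v ∉ ball j →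
             Geodesic (suc j) v

  geodesic⇒ball : ∀ {j v} → Geodesic j v → v ∈ ball j
  geodesic⇒ball root                   = x∈⁅x⁆ r
  geodesic⇒ball (extend {j} g uv v∈X _) = ball-step⁺ j (geodesic⇒ball g) uv v∈X

  ball⇒geodesic : ∀ j {v} → v ∈ ball j → ∃ λ i → i ≤ j × Geodesic i v
  ball⇒geodesic zero v∈ rewrite x∈⁅y⁆⇒x≡y r v∈ = 0 , z≤n , root
  ball⇒geodesic (suc j) {v} v∈ with v ∈? ball j | ball-step⁻ j v∈
  ... | yes v∈ball | _ with ball⇒geodesic j v∈ball
  ...   | i , i≤j , g = i , m≤n⇒m≤1+n i≤j , g
  ball⇒geodesic (suc j) v∈ | no v∉ball | inj₁ v∈ball = ⊥-elim (v∉ball v∈ball)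
  ball⇒geodesic (suc j) v∈ | no v∉ball | inj₂ (u , u∈ball , uv , v∈X)
    with ball⇒geodesic j u∈ball
  ... | i , i≤j , g = suc i , s≤s i≤j , extend g uv v∈X (v∉ball ∘ ball-mono i≤j)

  geodesic-prefix : ∀ {i j v} → i ≤′ j → Geodesic j v → ∃ (Geodesic i)
  geodesic-prefix ≤′-refl        g                  = _ , g
  geodesic-prefix (≤′-step i≤j) (extend g _ _ _)  = geodesic-prefix i≤j g

  -- A geodesic is read from its endpoint: vertex g i lies at distance j - i from r.
  vertex : ∀ {j v} → Geodesic j v → Fin (suc j) → Fin n
  vertex {v = v} _                0F      = v
  vertex         (extend g _ _ _) (suc i) = vertex g i

  vertex∈ball : ∀ {j v} (g : Geodesic j v) i → vertex g i ∈ ball j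
  vertex∈ball g                0F      = geodesic⇒ball g
  vertex∈ball (extend g _ _ _) (suc i) = p⊆p∪q _ (vertex∈ball g i)

  vertex-injective : ∀ {j v} (g : Geodesic j v) → Injective _≡_ _≡_ (vertex g)
  vertex-injective g                  {0F}    {0F}    _  = refl
  vertex-injective (extend g _ _ v∉)  {0F}    {suc i} eq =
    ⊥-elim (v∉ (subst (_∈ _) (sym eq) (vertex∈ball g i)))
  vertex-injective (extend g _ _ v∉)  {suc i} {0F}    eq =
    ⊥-elim (v∉ (subst (_∈ _) eq (vertex∈ball g i)))
  vertex-injective (extend g _ _ _)   {suc i} {suc j} eq = cong suc (vertex-injective g eq)

  endpoint-adjacency : ∀ {j v} (g : Geodesic j v) k →
                       adj (path (suc j)) 0F k ≡ adj G v (vertex g k)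
  endpoint-adjacency {v = v} g 0F = sym (adj-irrefl G v)
  endpoint-adjacency (extend {u = u} {v} _ uv _ _) 1F = trans (sym uv) (adj-sym G u v)
  endpoint-adjacency (extend (extend {j} g _ _ _) _ v∈X v∉) (suc (suc k)) =
    sym (¬-not λ vx → v∉ (ball-step⁺ j (vertex∈ball g k) (trans (adj-sym G _ _) vx) v∈X))

  vertex-adjacency : ∀ {j v} (g : Geodesic j v) i k →
                     adj (path (suc j)) i k ≡ adj G (vertex g i) (vertex g k)
  vertex-adjacency g 0F k = endpoint-adjacency g k
  vertex-adjacency g (suc i) 0F =
    trans (adj-sym (path _) (suc i) 0F) (trans (endpoint-adjacency g (suc i)) (adj-sym G _ _))
  vertex-adjacency (extend g _ _ _) (suc i) (suc k) =
    trans (path-adj-suc i k) (vertex-adjacency g i k)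

  geodesic⇒induced-path : ∀ {j v} → Geodesic j v → ContainsInduced G (path (suc j))
  geodesic⇒induced-path g = vertex g , vertex-injective g , vertex-adjacency g

  path-free⇒geodesic-length< : ∀ {m j v} → Free G (path m) → Geodesic j v → j < m
  path-free⇒geodesic-length< {zero}      free _ = ⊥-elim (free (path-zero-induced G))
  path-free⇒geodesic-length< {suc k} {j} free g with j ≤? k
  ... | yes j≤k = s≤s j≤k
  ... | no  j≰k = ⊥-elim (free (geodesic⇒induced-path (proj₂ prefix)))
    where
    prefix : ∃ (Geodesic k)
    prefix = geodesic-prefix (≤⇒≤′ (<⇒≤ (≰⇒> j≰k))) g

  path-free⇒reachable∈ball : ∀ {m v} → Free G (path m) → Reach G X r v → v ∈ ball m
  path-free⇒reachable∈ball free r⇝v with reach⇒ball r⇝v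
  ... | j , v∈ball with ball⇒geodesic j v∈ball
  ...   | i , _ , g = ball-mono (<⇒≤ (path-free⇒geodesic-length< free g)) (geodesic⇒ball g)

path-free-connected⇒∣X∣≤ : (G : Graph n) → ∀ {m X Δ} → Free G (path m) → Connected G X →
  (∀ {u} → u ∈ X → ∣ neighbours G u ∩ X ∣ ≤ Δ) → ∣ X ∣ ≤ suc Δ ^ m
path-free-connected⇒∣X∣≤ G {m} {X} free connected degree = ∣p∣≤k-from-Nonempty λ (r , r∈X) →
  let open Ball G X r in
  ≤-trans (p⊆q⇒∣p∣≤∣q∣ (λ v∈X → path-free⇒reachable∈ball free (connected r _ r∈X v∈X)))
          (∣ball∣≤ r∈X degree m)

lemma4 : (m c d : ℕ) → Σ ℕ λ f →
    ∀ (n : ℕ) (G : Graph n) (S T : Subset n) →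
    Free G (path m) → Free G coK3+2P1 →
    (∀ v → v ∈ S → v ∈ T → ⊥) →
    ∣ S ∣ ≤ c →
    ColourableOn G T d →
    Connected G (T ∪ S) →
    (∀ x₁ x₂ → x₁ ∈ T → x₂ ∈ T → x₁ ≢ x₂ → adj G x₁ x₂ ≡ false →
      ∀ s → s ∈ S → adj G s x₁ ≡ false ⊎ adj G s x₂ ≡ false) →
    (Σ (Fin n) λ w → w ∉ S × w ∉ T × (∀ v → v ∈ S ∪ T → adj G w v ≡ true)) →
    ∣ T ∣ ≤ f
lemma4 m c d = suc (d * 2 + c) ^ m ,
  λ { n G S T P-free coK3+2P1-free _ ∣S∣≤c colouring connected _ (w , _ , _ , w~S∪T) →
    let w~ : T ∪ S ⊆ neighbours G w
        w~ {v} v∈ = x∈subsetOf⁺ _ (w~S∪T v (subst (v ∈_) (∪-comm T S) v∈))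
        degree : ∀ {u} → u ∈ T ∪ S → ∣ neighbours G u ∩ (T ∪ S) ∣ ≤ d * 2 + c
        degree {u} u∈ = ≤-trans
          (∣neighbours∩T∪S∣≤d*2+∣S∣ G coK3+2P1-free colouring
            (trans (adj-sym G u w) (x∈subsetOf⁻ _ (w~ u∈))) (w~ ∘ x∈p∪q⁺ ∘ inj₁))
          (+-monoʳ-≤ (d * 2) ∣S∣≤c)
    in ≤-trans (∣p∣≤∣p∪q∣ T S) (path-free-connected⇒∣X∣≤ G P-free connected degree) }
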